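{- In the orientation of a path $P_n$ induced by a $p_2$-configuration, every flat edge $e_i$ is adjacent to two edges $e_{i-1}$ and $e_{i+1}$ (so $2\le i\le n-2$), one of which is a right edge and the other a left edge.
   Context: Parallel Diffusion on a finite simple graph $G$: a configuration assigns an integer stack size $|v|$ (possibly negative) to each vertex. In one step all vertices fire simultaneously: each vertex sends one chip to each neighbour with strictly smaller stack size. Starting from $C_0$, $C_{t+1}$ is obtained from $C_t$ by one step. A configuration $D$ is a $p_2$-configuration if there are $C_0$ and $N$ such that $C_{t+2}=C_t$ and $C_{t+1}\ne C_t$ for all $t\ge N$, and $D=C_t$ for some $t\ge N$. The path $P_n$ has vertices $v_1,\dots,v_n$ and edges $e_i=v_iv_{i+1}$, drawn horizontally with $v_1$ rightmost. A configuration induces the orientation in which each edge is directed from its endpoint with larger stack size to its endpoint with smaller stack size, and is flat if the stack sizes are equal. A directed edge $e_i$ is a right edge if directed $v_{i+1}\to v_i$ and a left edge if directed $v_i\to v_{i+1}$. -}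

module Defs where

open import Data.Nat as ℕ using (ℕ; zero; suc; _∸_)
open import Data.Bool.Properties using (∨-comm)
open import Data.Integer as ℤ using (ℤ; _+_; _-_; 0ℤ; 1ℤ; -1ℤ)
open import Data.Fin as Fin using (Fin; toℕ; fromℕ<)
open import Data.Bool using (Bool; true; false; if_then_else_; _∨_)
open import Data.Product using (Σ; _×_; ∃; _,_)
open import Relation.Nullary using (¬_; yes; no)
import Relation.Binary.PropositionalEquality
open Relation.Binary.PropositionalEquality using (_≡_)

Config : ℕ → Set
Config n = Fin n → ℤ

record Graph (n : ℕ) : Set where
  field
    adj   : Fin n → Fin n → Bool
    sym   : ∀ u v → adj u v ≡ adj v u
    irr   : ∀ v → adj v v ≡ false

sumFin : ∀ {n} → (Fin n → ℤ) → ℤ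
sumFin {zero}  f = 0ℤ
sumFin {suc n} f = f Fin.zero + sumFin (λ i → f (Fin.suc i))

-- Net chip change along one edge vu for vertex v (stack a = |v|, b = |u|):
-- v receives one chip if |u| > |v|, sends one if |u| < |v|.
flow : ℤ → ℤ → ℤ
flow a b with a ℤ.<? b
... | yes _ = 1ℤ
... | no _ with b ℤ.<? a
...   | yes _ = -1ℤ
...   | no _  = 0ℤ

step : ∀ {n} → Graph n → Config n → Config n
step G C v = C v + sumFin (λ u → if Graph.adj G v u then flow (C v) (C u) else 0ℤ)

iter : ∀ {n} → Graph n → Config n → ℕ → Config n
iter G C zero    = C
iter G C (suc t) = step G (iter G C t)

_≈_ : ∀ {n} → Config n → Config n → Set
C ≈ D = ∀ v → C v ≡ D v

IsP2 : ∀ {n} → Graph n → Config n → Set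
IsP2 {n} G D =
  Σ (Config n) λ C₀ → Σ ℕ λ N →
    (∀ t → N ℕ.≤ t →
        (iter G C₀ (suc (suc t)) ≈ iter G C₀ t)
      × ¬ (iter G C₀ (suc t) ≈ iter G C₀ t))
    × Σ ℕ λ t → N ℕ.≤ t × (D ≈ iter G C₀ t)

-- The path P_n: vertex v_k (1 ≤ k ≤ n) is Fin index k-1; v_k ~ v_{k+1}.
pathAdj : ∀ {n} → Fin n → Fin n → Bool
pathAdj u v = (toℕ u ℕ.≡ᵇ suc (toℕ v)) ∨ (toℕ v ℕ.≡ᵇ suc (toℕ u))

pathSym : ∀ {n} (u v : Fin n) → pathAdj u v ≡ pathAdj v u
pathSym u v = ∨-comm (toℕ u ℕ.≡ᵇ suc (toℕ v)) (toℕ v ℕ.≡ᵇ suc (toℕ u))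

pathIrr : ∀ {n} (v : Fin n) → pathAdj v v ≡ false
pathIrr v = lemma (toℕ v)
  where
  open Relation.Binary.PropositionalEquality using (refl)
  lemma : ∀ k → ((k ℕ.≡ᵇ suc k) ∨ (k ℕ.≡ᵇ suc k)) ≡ false
  lemma zero = refl
  lemma (suc k) = lemma k

P : (n : ℕ) → Graph n
P n = record { adj = pathAdj ; sym = pathSym ; irr = pathIrr }

-- Stack size |v_k| of the k-th vertex (1-indexed); 0 outside 1..n
-- (only ever used for 1 ≤ k ≤ n).
at : ∀ {n} → Config n → ℕ → ℤ
at {n} C k with (k ∸ 1) ℕ.<? n
... | yes p = C (fromℕ< p)
... | no _  = 0ℤ

-- Edge e_i = v_i v_{i+1}.
Flat : ∀ {n} → Config n → ℕ → Set
Flat C i = at C i ≡ at C (suc i)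

-- right edge: directed v_{i+1} → v_i, i.e. |v_{i+1}| > |v_i|
RightEdge : ∀ {n} → Config n → ℕ → Set
RightEdge C i = at C i ℤ.< at C (suc i)

-- left edge: directed v_i → v_{i+1}, i.e. |v_i| > |v_{i+1}|
LeftEdge : ∀ {n} → Config n → ℕ → Set
LeftEdge C i = at C (suc i) ℤ.< at C i

module Submission where

-- One step changes |v_k| by σ_k − σ_{k−1}, where σ_k = edgeFlow C k is 1, −1 or 0 according as e_k is
-- a right, left or flat edge, and σ_0 = σ_n = 0. If E has period two with successor E′, the changes of
-- two consecutive steps cancel at every vertex, so telescoping from v_1 gives σ_k(E) + σ_k(E′) = 0:
-- every edge reverses at each step. A flat edge e_k thus stays flat, and comparing the changes at its
-- two endpoints gives σ_{k+1} = −σ_{k−1}. Were this zero, flatness of two adjacent edges would spread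
-- along the whole path in both directions and E would be fixed; so σ_{k−1} = −σ_{k+1} ≠ 0, which also
-- forces both neighbouring edges to exist.

open import Defs
open import Data.Nat using (ℕ; suc; _≤_; _+_; _∸_)
open import Data.Product using (_×_)
open import Data.Sum using (_⊎_)

open import Data.Bool using (if_then_else_; _∨_)
open import Data.Empty using (⊥-elim)
open import Data.Fin as Fin using (Fin; toℕ; fromℕ<)
import Data.Fin.Properties as FinP
open import Data.Integer as ℤ using (ℤ; 0ℤ; 1ℤ; -1ℤ; -_; _-_) renaming (_+_ to _+ℤ_)
import Data.Integer.Properties as ℤP
open import Algebra.Properties.AbelianGroup ℤP.+-0-abelianGroup using (∙-cancelˡ; identityʳ-unique)
open import Algebra.Properties.CommutativeSemigroup ℤP.+-commutativeSemigroup using (interchange)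
open import Data.Nat as ℕ using (zero; z≤n; s≤s; _<_)
import Data.Nat.Properties as ℕP
open import Data.Product using (_,_; proj₁; proj₂; map₂)
open import Data.Sum using (inj₁; inj₂)
open import Function using (_∘_)
open import Relation.Binary.Definitions using (tri<; tri≈; tri>)
open import Relation.Binary.PropositionalEquality
open import Relation.Nullary using (¬_; yes; no)

flow-< : ∀ {x y} → x ℤ.< y → flow x y ≡ 1ℤ
flow-< {x} {y} x<y with x ℤ.<? y
... | yes _  = refl
... | no x≮y = ⊥-elim (x≮y x<y)

flow-> : ∀ {x y} → y ℤ.< x → flow x y ≡ -1ℤ
flow-> {x} {y} y<x with x ℤ.<? y
... | yes x<y = ⊥-elim (ℤP.<-asym x<y y<x)
... | no _ with y ℤ.<? x
...   | yes _  = refl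
...   | no y≮x = ⊥-elim (y≮x y<x)

flow-refl : ∀ x → flow x x ≡ 0ℤ
flow-refl x with x ℤ.<? x
... | yes x<x = ⊥-elim (ℤP.<-irrefl refl x<x)
... | no _ with x ℤ.<? x
...   | yes x<x = ⊥-elim (ℤP.<-irrefl refl x<x)
...   | no _    = refl

flow-antisym : ∀ x y → flow x y ≡ - flow y x
flow-antisym x y with ℤP.<-cmp x y
... | tri< x<y _ _  = trans (flow-< x<y) (cong -_ (sym (flow-> x<y)))
... | tri≈ _ refl _ = trans (flow-refl x) (cong -_ (sym (flow-refl x)))
... | tri> _ _ y<x  = trans (flow-> y<x) (cong -_ (sym (flow-< y<x)))

flow-cases : ∀ x y → flow x y ≡ 1ℤ ⊎ flow x y ≡ -1ℤ ⊎ flow x y ≡ 0ℤ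
flow-cases x y with ℤP.<-cmp x y
... | tri< x<y _ _  = inj₁ (flow-< x<y)
... | tri≈ _ refl _ = inj₂ (inj₂ (flow-refl x))
... | tri> _ _ y<x  = inj₂ (inj₁ (flow-> y<x))

flow≡0⇒≡ : ∀ {x y} → flow x y ≡ 0ℤ → x ≡ y
flow≡0⇒≡ {x} {y} e with ℤP.<-cmp x y
... | tri< x<y _ _ with () ← trans (sym (flow-< x<y)) e
... | tri≈ _ x≡y _ = x≡y
... | tri> _ _ y<x with () ← trans (sym (flow-> y<x)) e

flow≡1⇒< : ∀ {x y} → flow x y ≡ 1ℤ → x ℤ.< y
flow≡1⇒< {x} {y} e with ℤP.<-cmp x y
... | tri< x<y _ _  = x<y
... | tri≈ _ refl _ with () ← trans (sym (flow-refl x)) e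
... | tri> _ _ y<x  with () ← trans (sym (flow-> y<x)) e

flow≡-1⇒> : ∀ {x y} → flow x y ≡ -1ℤ → y ℤ.< x
flow≡-1⇒> {x} {y} e with ℤP.<-cmp x y
... | tri< x<y _ _  with () ← trans (sym (flow-< x<y)) e
... | tri≈ _ refl _ with () ← trans (sym (flow-refl x)) e
... | tri> _ _ y<x  = y<x

at-cong : ∀ {n} {C D : Config n} → C ≈ D → ∀ k → at C k ≡ at D k
at-cong {n} C≈D k with (k ∸ 1) ℕ.<? n
... | yes _ = C≈D _
... | no _  = refl

at-fromℕ< : ∀ {n} (C : Config n) {k} (k<n : k < n) → at C (suc k) ≡ C (fromℕ< k<n)
at-fromℕ< {n} C {k} k<n with k ℕ.<? n
... | yes _  = refl
... | no k≮n = ⊥-elim (k≮n k<n)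

at-toℕ : ∀ {n} (C : Config n) (v : Fin n) → at C (suc (toℕ v)) ≡ C v
at-toℕ C v = trans (at-fromℕ< C (FinP.toℕ<n v)) (cong C (FinP.fromℕ<-toℕ v (FinP.toℕ<n v)))

-- pad F k is F at the 1-based position k and 0 outside 1..n, like `at` but defined by recursion on n
-- so that it follows the recursion of sumFin.
pad : ∀ {n} → (Fin n → ℤ) → ℕ → ℤ
pad F zero = 0ℤ
pad {zero}  F (suc k) = 0ℤ
pad {suc n} F (suc zero) = F Fin.zero
pad {suc n} F (suc (suc k)) = pad (F ∘ Fin.suc) (suc k)

pad-fromℕ< : ∀ {n} (F : Fin n → ℤ) {k} (k<n : k < n) → pad F (suc k) ≡ F (fromℕ< k<n)
pad-fromℕ< {suc n} F {zero}  _   = refl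
pad-fromℕ< {suc n} F {suc k} k<n = pad-fromℕ< (F ∘ Fin.suc) (ℕ.s<s⁻¹ k<n)

pad-outside : ∀ {n} (F : Fin n → ℤ) {k} → n < k → pad F k ≡ 0ℤ
pad-outside {zero}  F {suc k}       _         = refl
pad-outside {suc n} F {suc (suc k)} (s≤s n<k) = pad-outside (F ∘ Fin.suc) n<k

sumFin-zero : ∀ n → sumFin {n} (λ _ → 0ℤ) ≡ 0ℤ
sumFin-zero zero    = refl
sumFin-zero (suc n) = trans (ℤP.+-identityˡ _) (sumFin-zero n)

sumFin-single : ∀ {n} (F : Fin n → ℤ) k →
  sumFin (λ u → if toℕ u ℕ.≡ᵇ k then F u else 0ℤ) ≡ pad F (suc k)
sumFin-single {zero}  F k       = refl
sumFin-single {suc n} F zero    = trans (cong (F Fin.zero +ℤ_) (sumFin-zero n)) (ℤP.+-identityʳ _)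
sumFin-single {suc n} F (suc k) = trans (ℤP.+-identityˡ _) (sumFin-single (F ∘ Fin.suc) k)

sumFin-pathNeighbours : ∀ {n} (F : Fin n → ℤ) m →
  sumFin (λ u → if (m ℕ.≡ᵇ suc (toℕ u)) ∨ (toℕ u ℕ.≡ᵇ suc m) then F u else 0ℤ)
    ≡ pad F m +ℤ pad F (suc (suc m))
sumFin-pathNeighbours {zero}  F zero    = refl
sumFin-pathNeighbours {zero}  F (suc m) = refl
sumFin-pathNeighbours {suc n} F zero    = cong (0ℤ +ℤ_) (sumFin-single (F ∘ Fin.suc) 0)
sumFin-pathNeighbours {suc n} F (suc zero) = cong (F Fin.zero +ℤ_) (sumFin-single (F ∘ Fin.suc) 1)
sumFin-pathNeighbours {suc n} F (suc (suc m)) =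
  trans (ℤP.+-identityˡ _) (sumFin-pathNeighbours (F ∘ Fin.suc) (suc m))

edgeFlow : ∀ {n} → Config n → ℕ → ℤ
edgeFlow C zero = 0ℤ
edgeFlow {n} C (suc j) with n ℕ.≤? suc j
... | yes _ = 0ℤ
... | no _  = flow (at C (suc j)) (at C (suc (suc j)))

edgeFlow-inRange : ∀ {n} (C : Config n) {j} → suc (suc j) ≤ n →
  edgeFlow C (suc j) ≡ flow (at C (suc j)) (at C (suc (suc j)))
edgeFlow-inRange {n} C {j} r with n ℕ.≤? suc j
... | yes n≤1+j = ⊥-elim (ℕP.<⇒≱ r n≤1+j)
... | no _      = refl

edgeFlow-outOfRange : ∀ {n} (C : Config n) {k} → n ≤ k → edgeFlow C k ≡ 0ℤ
edgeFlow-outOfRange C {zero} _ = refl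
edgeFlow-outOfRange {n} C {suc j} n≤k with n ℕ.≤? suc j
... | yes _    = refl
... | no n≰1+j = ⊥-elim (n≰1+j n≤k)

edgeFlow-cong : ∀ {n} {C D : Config n} → C ≈ D → ∀ k → edgeFlow C k ≡ edgeFlow D k
edgeFlow-cong C≈D zero = refl
edgeFlow-cong {n} C≈D (suc j) with n ℕ.≤? suc j
... | yes _ = refl
... | no _  = cong₂ flow (at-cong C≈D (suc j)) (at-cong C≈D (suc (suc j)))

Flat⇒edgeFlow≡0 : ∀ {n} (C : Config n) k → Flat C k → edgeFlow C k ≡ 0ℤ
Flat⇒edgeFlow≡0 C zero _ = refl
Flat⇒edgeFlow≡0 {n} C (suc j) flat with n ℕ.≤? suc j
... | yes _ = refl
... | no _  = trans (cong (flow (at C (suc j))) (sym flat)) (flow-refl (at C (suc j)))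

edgeFlow≡0⇒Flat : ∀ {n} {C : Config n} {j} → suc (suc j) ≤ n →
  edgeFlow C (suc j) ≡ 0ℤ → Flat C (suc j)
edgeFlow≡0⇒Flat {C = C} r e = flow≡0⇒≡ (trans (sym (edgeFlow-inRange C r)) e)

pad-flow : ∀ {n} (C : Config n) x {k} → k < n → pad (flow x ∘ C) (suc k) ≡ flow x (at C (suc k))
pad-flow C x k<n = trans (pad-fromℕ< (flow x ∘ C) k<n) (cong (flow x) (sym (at-fromℕ< C k<n)))

pad-flow≡edgeFlow : ∀ {n} (C : Config n) m →
  pad (flow (at C (suc m)) ∘ C) (suc (suc m)) ≡ edgeFlow C (suc m)
pad-flow≡edgeFlow {n} C m with suc m ℕ.<? n
... | yes r     = trans (pad-flow C (at C (suc m)) r) (sym (edgeFlow-inRange C r))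
... | no 1+m≮n = trans (pad-outside _ (ℕP.≤-<-trans n≤1+m (ℕP.n<1+n (suc m))))
                        (sym (edgeFlow-outOfRange C n≤1+m))
  where
  n≤1+m : n ≤ suc m
  n≤1+m = ℕP.≮⇒≥ 1+m≮n

pad-flow≡-edgeFlow : ∀ {n} (C : Config n) m → m < n →
  pad (flow (at C (suc m)) ∘ C) m ≡ - edgeFlow C m
pad-flow≡-edgeFlow C zero    _ = refl
pad-flow≡-edgeFlow C (suc j) r = begin
  pad (flow (at C (suc (suc j))) ∘ C) (suc j)
    ≡⟨ pad-flow C (at C (suc (suc j))) (ℕP.<-trans (ℕP.n<1+n j) r) ⟩
  flow (at C (suc (suc j))) (at C (suc j))
    ≡⟨ flow-antisym (at C (suc (suc j))) (at C (suc j)) ⟩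
  - flow (at C (suc j)) (at C (suc (suc j)))
    ≡⟨ cong -_ (sym (edgeFlow-inRange C r)) ⟩
  - edgeFlow C (suc j) ∎
  where open ≡-Reasoning

at-step : ∀ {n} (C : Config n) m → m < n →
  at (step (P n) C) (suc m) ≡ at C (suc m) +ℤ (edgeFlow C (suc m) - edgeFlow C m)
at-step {n} C m m<n = begin
  at (step (P n) C) (suc m)
    ≡⟨ at-fromℕ< (step (P n) C) m<n ⟩
  C v +ℤ sumFin (λ u → if pathAdj v u then flow (C v) (C u) else 0ℤ)
    ≡⟨ cong (λ k → C v +ℤ neighbours (C v) k) (FinP.toℕ-fromℕ< m<n) ⟩
  C v +ℤ neighbours (C v) m
    ≡⟨ cong (λ x → x +ℤ neighbours x m) (sym (at-fromℕ< C m<n)) ⟩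
  x₀ +ℤ neighbours x₀ m
    ≡⟨ cong (x₀ +ℤ_) (sumFin-pathNeighbours (flow x₀ ∘ C) m) ⟩
  x₀ +ℤ (pad (flow x₀ ∘ C) m +ℤ pad (flow x₀ ∘ C) (suc (suc m)))
    ≡⟨ cong (x₀ +ℤ_) (ℤP.+-comm (pad (flow x₀ ∘ C) m) _) ⟩
  x₀ +ℤ (pad (flow x₀ ∘ C) (suc (suc m)) +ℤ pad (flow x₀ ∘ C) m)
    ≡⟨ cong₂ (λ r l → x₀ +ℤ (r +ℤ l)) (pad-flow≡edgeFlow C m) (pad-flow≡-edgeFlow C m m<n) ⟩
  x₀ +ℤ (edgeFlow C (suc m) - edgeFlow C m) ∎
  where
  open ≡-Reasoning
  v : Fin n
  v = fromℕ< m<n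
  x₀ : ℤ
  x₀ = at C (suc m)
  neighbours : ℤ → ℕ → ℤ
  neighbours x k = sumFin (λ u → if (k ℕ.≡ᵇ suc (toℕ u)) ∨ (toℕ u ℕ.≡ᵇ suc k) then flow x (C u) else 0ℤ)

edgeFlow-cases : ∀ {n} (C : Config n) k →
  edgeFlow C k ≡ 1ℤ ⊎ edgeFlow C k ≡ -1ℤ ⊎ edgeFlow C k ≡ 0ℤ
edgeFlow-cases C zero = inj₂ (inj₂ refl)
edgeFlow-cases {n} C (suc j) with n ℕ.≤? suc j
... | yes _ = inj₂ (inj₂ refl)
... | no _  = flow-cases (at C (suc j)) (at C (suc (suc j)))

edgeFlow≡1⇒RightEdge : ∀ {n} (C : Config n) k → edgeFlow C k ≡ 1ℤ → suc k ≤ n × RightEdge C k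
edgeFlow≡1⇒RightEdge C zero ()
edgeFlow≡1⇒RightEdge {n} C (suc j) e with n ℕ.≤? suc j
edgeFlow≡1⇒RightEdge {n} C (suc j) () | yes _
... | no n≰1+j = ℕP.≰⇒> n≰1+j , flow≡1⇒< e

edgeFlow≡-1⇒LeftEdge : ∀ {n} (C : Config n) k → edgeFlow C k ≡ -1ℤ → suc k ≤ n × LeftEdge C k
edgeFlow≡-1⇒LeftEdge C zero ()
edgeFlow≡-1⇒LeftEdge {n} C (suc j) e with n ℕ.≤? suc j
edgeFlow≡-1⇒LeftEdge {n} C (suc j) () | yes _
... | no n≰1+j = ℕP.≰⇒> n≰1+j , flow≡-1⇒> e

opposite-flows⇒opposite-edges : ∀ {n} (C : Config n) j k →
  edgeFlow C k ≡ - edgeFlow C j → ¬ edgeFlow C j ≡ 0ℤ →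
  suc k ≤ n × ((RightEdge C j × LeftEdge C k) ⊎ (LeftEdge C j × RightEdge C k))
opposite-flows⇒opposite-edges C j k opposite nonflat with edgeFlow-cases C j
... | inj₁ right =
  map₂ (λ left → inj₁ (proj₂ (edgeFlow≡1⇒RightEdge C j right) , left))
       (edgeFlow≡-1⇒LeftEdge C k (trans opposite (cong -_ right)))
... | inj₂ (inj₁ left) =
  map₂ (λ right → inj₂ (proj₂ (edgeFlow≡-1⇒LeftEdge C j left) , right))
       (edgeFlow≡1⇒RightEdge C k (trans opposite (cong -_ left)))
... | inj₂ (inj₂ flat) = ⊥-elim (nonflat flat)

module TwoPeriodic {n} (E : Config n)
  (period : step (P n) (step (P n) E) ≈ E) (moving : ¬ step (P n) E ≈ E) where

  private
    E′ : Config n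
    E′ = step (P n) E

    σ τ : ℕ → ℤ
    σ = edgeFlow E
    τ = edgeFlow E′

  edgeFlows-cancel : ∀ k → edgeFlow E k +ℤ edgeFlow E′ k ≡ 0ℤ
  edgeFlows-cancel zero = refl
  edgeFlows-cancel (suc j) with j ℕ.<? n
  ... | no j≮n = cong₂ _+ℤ_ (edgeFlow-outOfRange E n≤1+j) (edgeFlow-outOfRange E′ n≤1+j)
    where
    n≤1+j : n ≤ suc j
    n≤1+j = ℕP.m≤n⇒m≤1+n (ℕP.≮⇒≥ j≮n)
  ... | yes j<n = begin
    σ (suc j) +ℤ τ (suc j)
      ≡⟨ ℤP.+-identityʳ _ ⟨
    (σ (suc j) +ℤ τ (suc j)) - 0ℤ
      ≡⟨ cong (λ s → (σ (suc j) +ℤ τ (suc j)) - s) (edgeFlows-cancel j) ⟨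
    (σ (suc j) +ℤ τ (suc j)) - (σ j +ℤ τ j)
      ≡⟨ cong ((σ (suc j) +ℤ τ (suc j)) +ℤ_) (ℤP.neg-distrib-+ (σ j) (τ j)) ⟩
    (σ (suc j) +ℤ τ (suc j)) +ℤ (- σ j +ℤ - τ j)
      ≡⟨ interchange (σ (suc j)) (τ (suc j)) (- σ j) (- τ j) ⟩
    (σ (suc j) - σ j) +ℤ (τ (suc j) - τ j)
      ≡⟨ identityʳ-unique (at E (suc j)) _ twoSteps ⟩
    0ℤ ∎
    where
    open ≡-Reasoning
    twoSteps : at E (suc j) +ℤ ((σ (suc j) - σ j) +ℤ (τ (suc j) - τ j)) ≡ at E (suc j)
    twoSteps = begin
      at E (suc j) +ℤ ((σ (suc j) - σ j) +ℤ (τ (suc j) - τ j))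
        ≡⟨ ℤP.+-assoc (at E (suc j)) _ _ ⟨
      (at E (suc j) +ℤ (σ (suc j) - σ j)) +ℤ (τ (suc j) - τ j)
        ≡⟨ cong (_+ℤ (τ (suc j) - τ j)) (at-step E j j<n) ⟨
      at E′ (suc j) +ℤ (τ (suc j) - τ j)
        ≡⟨ at-step E′ j j<n ⟨
      at (step (P n) E′) (suc j)
        ≡⟨ at-cong period (suc j) ⟩
      at E (suc j) ∎

  flatEdge-neighbours-opposite : ∀ j → suc (suc j) ≤ n → edgeFlow E (suc j) ≡ 0ℤ →
    edgeFlow E (suc (suc j)) ≡ - edgeFlow E j
  flatEdge-neighbours-opposite j r σ≡0 = begin
    σ (suc (suc j))
      ≡⟨ ℤP.+-identityʳ _ ⟨
    σ (suc (suc j)) - 0ℤ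
      ≡⟨ cong (λ s → σ (suc (suc j)) - s) σ≡0 ⟨
    σ (suc (suc j)) - σ (suc j)
      ≡⟨ ∙-cancelˡ (at E (suc j)) _ _ endpoints ⟨
    σ (suc j) - σ j
      ≡⟨ cong (_- σ j) σ≡0 ⟩
    0ℤ - σ j
      ≡⟨ ℤP.+-identityˡ _ ⟩
    - σ j ∎
    where
    open ≡-Reasoning
    τ≡0 : τ (suc j) ≡ 0ℤ
    τ≡0 = trans (sym (ℤP.+-identityˡ _))
                (trans (cong (_+ℤ τ (suc j)) (sym σ≡0)) (edgeFlows-cancel (suc j)))
    endpoints : at E (suc j) +ℤ (σ (suc j) - σ j) ≡ at E (suc j) +ℤ (σ (suc (suc j)) - σ (suc j))
    endpoints = begin
      at E (suc j) +ℤ (σ (suc j) - σ j)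
        ≡⟨ at-step E j (ℕP.<⇒≤ r) ⟨
      at E′ (suc j)
        ≡⟨ edgeFlow≡0⇒Flat r τ≡0 ⟩
      at E′ (suc (suc j))
        ≡⟨ at-step E (suc j) r ⟩
      at E (suc (suc j)) +ℤ (σ (suc (suc j)) - σ (suc j))
        ≡⟨ cong (_+ℤ (σ (suc (suc j)) - σ (suc j))) (edgeFlow≡0⇒Flat r σ≡0) ⟨
      at E (suc j) +ℤ (σ (suc (suc j)) - σ (suc j)) ∎

  ¬allEdgesFlat : ¬ (∀ k → edgeFlow E k ≡ 0ℤ)
  ¬allEdgesFlat allFlat = moving λ v → begin
    E′ v
      ≡⟨ at-toℕ E′ v ⟨
    at E′ (suc (toℕ v))
      ≡⟨ at-step E (toℕ v) (FinP.toℕ<n v) ⟩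
    at E (suc (toℕ v)) +ℤ (σ (suc (toℕ v)) - σ (toℕ v))
      ≡⟨ cong₂ (λ r l → at E (suc (toℕ v)) +ℤ (r - l)) (allFlat (suc (toℕ v))) (allFlat (toℕ v)) ⟩
    at E (suc (toℕ v)) +ℤ 0ℤ
      ≡⟨ ℤP.+-identityʳ _ ⟩
    at E (suc (toℕ v))
      ≡⟨ at-toℕ E v ⟩
    E v ∎
    where open ≡-Reasoning

  adjacentEdges-notBothFlat : ∀ j → j < n → edgeFlow E j ≡ 0ℤ → ¬ edgeFlow E (suc j) ≡ 0ℤ
  adjacentEdges-notBothFlat zero _ _ σ₁≡0 = ¬allEdgesFlat (λ k → proj₁ (flatFrom k))
    where
    flatFrom : ∀ k → σ k ≡ 0ℤ × σ (suc k) ≡ 0ℤ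
    flatFrom zero = refl , σ₁≡0
    flatFrom (suc k) with flatFrom k | suc k ℕ.<? n
    ... | σₖ≡0 , σₖ₊₁≡0 | yes r =
      σₖ₊₁≡0 , trans (flatEdge-neighbours-opposite k r σₖ₊₁≡0) (cong -_ σₖ≡0)
    ... | _ , σₖ₊₁≡0 | no 1+k≮n =
      σₖ₊₁≡0 , edgeFlow-outOfRange E (ℕP.m≤n⇒m≤1+n (ℕP.≮⇒≥ 1+k≮n))
  adjacentEdges-notBothFlat (suc j) r σ₁₊ⱼ≡0 σ₂₊ⱼ≡0 =
    adjacentEdges-notBothFlat j (ℕP.<-trans (ℕP.n<1+n j) r)
      (ℤP.neg-injective (trans (sym (flatEdge-neighbours-opposite j r σ₁₊ⱼ≡0)) σ₂₊ⱼ≡0))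
      σ₁₊ⱼ≡0

  flatEdge-flanked : ∀ j → suc j < n → edgeFlow E (suc j) ≡ 0ℤ →
    1 ≤ j × edgeFlow E (suc (suc j)) ≡ - edgeFlow E j × ¬ edgeFlow E j ≡ 0ℤ
  flatEdge-flanked zero r σ₁≡0 = ⊥-elim (adjacentEdges-notBothFlat 0 (ℕP.<-trans (s≤s z≤n) r) refl σ₁≡0)
  flatEdge-flanked (suc j) r σ≡0 =
    s≤s z≤n ,
    flatEdge-neighbours-opposite (suc j) r σ≡0 ,
    λ σ′≡0 → adjacentEdges-notBothFlat (suc j) (ℕP.<-trans (ℕP.n<1+n (suc j)) r) σ′≡0 σ≡0

lemma2p3 : (n : ℕ) (D : Config n) → IsP2 (P n) D →
    (i : ℕ) → 1 ≤ i → suc i ≤ n → Flat D i →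
      (2 ≤ i × i + 2 ≤ n)
      × ((RightEdge D (i ∸ 1) × LeftEdge D (suc i))
         ⊎ (LeftEdge D (i ∸ 1) × RightEdge D (suc i)))
lemma2p3 n D (C₀ , N , periodic , t , N≤t , D≈Cₜ) (suc j) _ i<n flat =
  (s≤s (proj₁ flanked) , subst (_≤ n) (ℕP.+-comm 2 (suc j)) (proj₁ oriented)) , proj₂ oriented
  where
  Cₜ : Config n
  Cₜ = iter (P n) C₀ t
  open TwoPeriodic Cₜ (proj₁ (periodic t N≤t)) (proj₂ (periodic t N≤t))
  sameFlows : ∀ k → edgeFlow D k ≡ edgeFlow Cₜ k
  sameFlows = edgeFlow-cong D≈Cₜ
  flanked : 1 ≤ j × edgeFlow Cₜ (suc (suc j)) ≡ - edgeFlow Cₜ j × ¬ edgeFlow Cₜ j ≡ 0ℤ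
  flanked = flatEdge-flanked j i<n (trans (sym (sameFlows (suc j))) (Flat⇒edgeFlow≡0 D (suc j) flat))
  oriented : suc (suc (suc j)) ≤ n
    × ((RightEdge D j × LeftEdge D (suc (suc j))) ⊎ (LeftEdge D j × RightEdge D (suc (suc j))))
  oriented = opposite-flows⇒opposite-edges D j (suc (suc j))
    (trans (sameFlows (suc (suc j))) (trans (proj₁ (proj₂ flanked)) (cong -_ (sym (sameFlows j)))))
    (proj₂ (proj₂ flanked) ∘ trans (sym (sameFlows j)))
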